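{- Let $n\ge 1$, $m_1,\dots,m_n\ge 1$, $X=\prod_{i=1}^n\{0,\dots,m_i\}$, $m=\sum_i m_i$, and let $\beta$ and $\mathcal{A}=\beta(X)\subseteq\{0,1\}^m$ be as in the context. Let $f\colon X\to X$ be a map and $F\colon\{0,1\}^m\to\{0,1\}^m$ a Boolean conversion of $f$ such that for all $x\in\{0,1\}^m$ and all $i=1,\dots,n$ we have $F(x)\in\mathcal{A}$ and $\left|\sum_{j=1}^{m_i}F_{i,j}(x)-\sum_{j=1}^{m_i}x_{i,j}\right|\le 1$. Then for every $x\in\{0,1\}^m$ there exists a path from $x$ to a state of $\mathcal{A}$ in the asynchronous dynamics $AD_F$.
   Context: The coordinates of $\{0,1\}^m$ are indexed by pairs in $I=\{(i,j)\mid 1\le i\le n,\ 1\le j\le m_i\}$. The map $\beta\colon X\to\{0,1\}^m$ is defined by $\beta_{i,j}(x)=1$ if $x_i\ge j$ and $0$ otherwise; $\mathcal{A}=\beta(X)$ is the set of admissible states (the $y\in\{0,1\}^m$ with $y_{i,j}=1\Rightarrow y_{i,h}=1$ for all $h<j$). A Boolean conversion of $f$ is any $F\colon\{0,1\}^m\to\{0,1\}^m$ with $F\circ\beta=\beta\circ f$. The asynchronous dynamics $AD_F$ of a Boolean map $F$ is the directed graph on $\{0,1\}^m$ with an edge from $x$ to the state obtained from $x$ by flipping coordinate $(i,j)$ whenever $F_{i,j}(x)\neq x_{i,j}$. -}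

module Defs where

open import Data.Nat using (ℕ; zero; suc; _+_; _<_; _≤_; ∣_-_∣)
open import Data.Fin using (Fin; toℕ; _≟_) renaming (zero to fzero; suc to fsuc)
open import Data.Bool using (Bool; true; false; not; if_then_else_)
open import Data.Product using (Σ; ∃; _×_; _,_)
open import Relation.Binary.PropositionalEquality using (_≡_; refl)
open import Relation.Nullary using (Dec; yes; no; does)
open import Relation.Nullary.Decidable using (⌊_⌋)
open import Relation.Binary.Construct.Closure.ReflexiveTransitive using (Star)

X : (n : ℕ) → (Fin n → ℕ) → Set
X n ms = (i : Fin n) → Fin (suc (ms i))

-- Boolean states {0,1}^m, coordinates indexed by pairs (i,j) with
-- 1 ≤ j ≤ m_i; the coordinate j is represented by (j - 1) : Fin (ms i).
B : (n : ℕ) → (Fin n → ℕ) → Set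
B n ms = (i : Fin n) → Fin (ms i) → Bool

-- β_{i,j}(x) = 1 iff x_i ≥ j, i.e. (with j represented by j-1) toℕ j < x_i.
β : ∀ {n ms} → X n ms → B n ms
β x i j = ⌊ Data.Nat._<?_ (toℕ j) (toℕ (x i)) ⌋
  where import Data.Nat

_≗B_ : ∀ {n ms} → B n ms → B n ms → Set
y ≗B z = ∀ i j → y i j ≡ z i j

Admissible : ∀ {n ms} → B n ms → Set
Admissible {n} {ms} y = Σ (X n ms) λ x → β x ≗B y

IsBooleanConversion : ∀ {n ms} → (X n ms → X n ms) → (B n ms → B n ms) → Set
IsBooleanConversion {n} {ms} f F = ∀ (x : X n ms) → F (β x) ≗B β (f x)

flipAt : ∀ {n ms} → B n ms → (i : Fin n) → Fin (ms i) → B n ms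
flipAt {n} {ms} y i j i′ j′ with i ≟ i′
... | yes refl = if ⌊ j ≟ j′ ⌋ then not (y i′ j′) else y i′ j′
... | no _ = y i′ j′

ADEdge : ∀ {n ms} → (B n ms → B n ms) → B n ms → B n ms → Set
ADEdge {n} {ms} F y z =
  Σ (Fin n) λ i → Σ (Fin (ms i)) λ j →
    (F y i j ≡ not (y i j)) × (z ≗B flipAt y i j)

Path : ∀ {n ms} → (B n ms → B n ms) → B n ms → B n ms → Set
Path F = Star (ADEdge F)

bsum : ∀ {k} → (Fin k → Bool) → ℕ
bsum {zero} v = 0
bsum {suc k} v = (if v fzero then 1 else 0) + bsum (λ j → v (fsuc j))

-- Count, in each block y_i, the inversions: pairs j < j′ with y_{i,j} = 0 and
-- y_{i,j′} = 1.  A block is admissible exactly when it has none.  If a block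
-- v has an inversion, let c = Σ_j F_{i,j}(y); F_i(y) is admissible, so it is
-- the block of c leading ones, and |c − Σ_j v_j| ≤ 1.  Scanning v from the
-- left, the first position where it disagrees with that block can be flipped
-- (F allows it) and the flip removes an inversion; so every state reaches an
-- inversion-free, i.e. admissible, state.
module Submission where

open import Defs
open import Data.Nat using (ℕ; zero; suc; _+_; _≤_; _<_; _<?_; _≟_; ∣_-_∣; z≤n; s≤s; s≤s⁻¹)
open import Data.Nat.Properties
  using (+-0-monoid; +-suc; +-monoˡ-<; +-monoʳ-<; m<n+m; m≤n⇒m≤1+n; n≤0⇒n≡0; >⇒≢; n≢0⇒n>0; m+n≡0⇒m≡0; m+n≡0⇒n≡0)
open import Data.Nat.Induction using (<-wellFounded)
open import Data.Fin using (Fin; toℕ; fromℕ<) renaming (zero to fzero; suc to fsuc)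
import Data.Fin as Fin
open import Data.Fin.Properties using (all?; ¬∀⟶∃¬; suc-injective; toℕ<n; toℕ-fromℕ<)
open import Data.Vec.Functional using (_∷_; head; tail; updateAt)
open import Data.Vec.Functional.Properties using (updateAt-updates; updateAt-minimal)
open import Algebra.Properties.Monoid.Sum +-0-monoid using (sum; sum-cong-≗)
open import Data.Bool using (Bool; true; false; not; if_then_else_)
open import Data.Product using (Σ; _×_; _,_; ∃-syntax)
open import Data.Empty using (⊥-elim)
open import Function using (_∘_)
open import Induction.WellFounded using (Acc; acc)
open import Relation.Binary.PropositionalEquality using (_≡_; _≢_; _≗_; refl; sym; trans; cong; cong₂; subst)
open import Relation.Binary.Construct.Closure.ReflexiveTransitive using (ε; _◅_)
open import Relation.Nullary using (yes; no; contradiction)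
open import Relation.Nullary.Decidable using (⌊_⌋; ⌊⌋-map′)

-- β x i = threshold (toℕ (x i)) holds definitionally.
threshold : ∀ {k} → ℕ → Fin k → Bool
threshold c j = ⌊ toℕ j <? c ⌋

threshold-suc : ∀ {k} c (j : Fin k) → threshold (suc c) (fsuc j) ≡ threshold c j
threshold-suc c j = trans (⌊⌋-map′ _ _ _) (sym (⌊⌋-map′ _ _ _))

inversions : ∀ {k} → (Fin k → Bool) → ℕ
inversions {zero} _ = 0
inversions {suc k} v = (if head v then 0 else bsum (tail v)) + inversions (tail v)

bsum-cong : ∀ {k} {v w : Fin k → Bool} → v ≗ w → bsum v ≡ bsum w
bsum-cong {zero} _ = refl
bsum-cong {suc k} v≗w = cong₂ _+_ (cong (λ b → if b then 1 else 0) (v≗w fzero)) (bsum-cong (v≗w ∘ fsuc))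

inversions-cong : ∀ {k} {v w : Fin k → Bool} → v ≗ w → inversions v ≡ inversions w
inversions-cong {zero} _ = refl
inversions-cong {suc k} v≗w =
  cong₂ _+_ (cong₂ (λ b s → if b then 0 else s) (v≗w fzero) (bsum-cong (v≗w ∘ fsuc)))
            (inversions-cong (v≗w ∘ fsuc))

bsum≤ : ∀ {k} (v : Fin k → Bool) → bsum v ≤ k
bsum≤ {zero} v = z≤n
bsum≤ {suc k} v with v fzero
... | true = s≤s (bsum≤ (tail v))
... | false = m≤n⇒m≤1+n (bsum≤ (tail v))

bsum-threshold : ∀ {k c} → c ≤ k → bsum (threshold {k} c) ≡ c
bsum-threshold {zero} z≤n = refl
bsum-threshold {suc k} {zero} _ = bsum-threshold {k} z≤n
bsum-threshold {suc k} {suc c} (s≤s c≤k) =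
  cong suc (trans (bsum-cong (threshold-suc {k} c)) (bsum-threshold c≤k))

bsum-β : ∀ {n ms} (x : X n ms) i → bsum (β x i) ≡ toℕ (x i)
bsum-β x i = bsum-threshold (s≤s⁻¹ (toℕ<n (x i)))

bsum>0⇒∃-true : ∀ {k} (v : Fin k → Bool) → 0 < bsum v → ∃[ j ] v j ≡ true
bsum>0⇒∃-true {suc k} v pos with v fzero in v₀
... | true = fzero , v₀
... | false with bsum>0⇒∃-true (tail v) pos
...   | j , vj = fsuc j , vj

bsum-updateAt-true : ∀ {k} (v : Fin k → Bool) j → v j ≡ true → suc (bsum (updateAt v j not)) ≡ bsum v
bsum-updateAt-true v fzero vj rewrite vj = refl
bsum-updateAt-true v (fsuc j) vj =
  trans (sym (+-suc v₀ _)) (cong (v₀ +_) (bsum-updateAt-true (tail v) j vj))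
  where
  v₀ : ℕ
  v₀ = if head v then 1 else 0

bsum≡0⇒inversions≡0 : ∀ {k} (v : Fin k → Bool) → bsum v ≡ 0 → inversions v ≡ 0
bsum≡0⇒inversions≡0 {zero} v _ = refl
bsum≡0⇒inversions≡0 {suc k} v e with v fzero
... | false = cong₂ _+_ e (bsum≡0⇒inversions≡0 (tail v) e)

bsum+inversions>0⇒bsum>0 : ∀ {k} (v : Fin k → Bool) → 0 < bsum v + inversions v → 0 < bsum v
bsum+inversions>0⇒bsum>0 v pos with bsum v in e
... | suc _ = s≤s z≤n
... | zero rewrite bsum≡0⇒inversions≡0 v e = pos

inversions≡0⇒threshold : ∀ {k} (v : Fin k → Bool) → inversions v ≡ 0 → v ≗ threshold (bsum v)
inversions≡0⇒threshold {suc k} v e j with v fzero in v₀ | j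
... | true | fzero = v₀
... | true | fsuc j′ = trans (inversions≡0⇒threshold (tail v) e j′) (sym (threshold-suc _ j′))
... | false | j′ = trans (v≡false j′) (sym (cong (λ c → threshold c j′) (m+n≡0⇒m≡0 _ e)))
  where
  v≡false : ∀ j → v j ≡ false
  v≡false fzero = v₀
  v≡false (fsuc j) = trans (inversions≡0⇒threshold (tail v) (m+n≡0⇒n≡0 _ e) j)
                           (cong (λ c → threshold c j) (m+n≡0⇒m≡0 _ e))

ImprovingFlip : ∀ {k} → ℕ → (Fin k → Bool) → Set
ImprovingFlip c v = ∃[ j ] threshold c j ≡ not (v j) × inversions (updateAt v j not) < inversions v

ImprovingFlip-η : ∀ {k} c (v : Fin (suc k) → Bool) → ImprovingFlip c (head v ∷ tail v) → ImprovingFlip c v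
ImprovingFlip-η c v (fzero , disagree , fewer) = fzero , disagree , fewer
ImprovingFlip-η c v (fsuc j , disagree , fewer) = fsuc j , disagree , fewer

improvingFlip : ∀ {k} c (v : Fin k → Bool) → 0 < inversions v → ∣ c - bsum v ∣ ≤ 1 → ImprovingFlip c v
-- Stated for b ∷ t so that the head can be matched on; ImprovingFlip-η transports it back.
improvingFlip-∷ : ∀ {k} c b (t : Fin k → Bool) →
  0 < inversions (b ∷ t) → ∣ c - bsum (b ∷ t) ∣ ≤ 1 → ImprovingFlip c (b ∷ t)

improvingFlip {suc k} c v pos close = ImprovingFlip-η c v (improvingFlip-∷ c (head v) (tail v) pos close)

improvingFlip-∷ (suc c) true t pos close with improvingFlip c t pos close
... | j , disagree , fewer = fsuc j , trans (threshold-suc c j) disagree , fewer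
improvingFlip-∷ (suc c) false t pos _ = fzero , refl , m<n+m (inversions t) (bsum+inversions>0⇒bsum>0 t pos)
improvingFlip-∷ zero true t pos close =
  ⊥-elim (>⇒≢ pos (bsum≡0⇒inversions≡0 t (n≤0⇒n≡0 (s≤s⁻¹ close))))
-- Here the target block is empty, so t holds a single one; flipping it leaves no inversion.
improvingFlip-∷ zero false t pos close with bsum>0⇒∃-true t (bsum+inversions>0⇒bsum>0 t pos)
... | j , tj = fsuc j , cong not (sym tj) , subst (_< bsum t + inversions t) (sym cleared) pos
  where
  t′ : Fin _ → Bool
  t′ = updateAt t j not
  t′-empty : bsum t′ ≡ 0
  t′-empty = n≤0⇒n≡0 (s≤s⁻¹ (subst (_≤ 1) (sym (bsum-updateAt-true t j tj)) close))
  cleared : bsum t′ + inversions t′ ≡ 0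
  cleared = cong₂ _+_ t′-empty (bsum≡0⇒inversions≡0 t′ t′-empty)

sum-decrease : ∀ {n} (g h : Fin n → ℕ) i → (∀ i′ → i′ ≢ i → h i′ ≡ g i′) → h i < g i → sum h < sum g
sum-decrease g h fzero same smaller =
  subst (λ s → h fzero + s < sum g) (sym (sum-cong-≗ (λ i′ → same (fsuc i′) (λ ())))) (+-monoˡ-< _ smaller)
sum-decrease g h (fsuc i) same smaller =
  subst (λ a → a + sum (tail h) < sum g) (sym (same fzero (λ ())))
    (+-monoʳ-< (g fzero) (sum-decrease (tail g) (tail h) i (λ i′ ne → same (fsuc i′) (ne ∘ suc-injective)) smaller))

flipAt-same : ∀ {n ms} (y : B n ms) i j → flipAt y i j i ≗ updateAt (y i) j not
flipAt-same y i j j′ with i Fin.≟ i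
... | no i≢i = contradiction refl i≢i
... | yes refl with j Fin.≟ j′
...   | yes refl = sym (updateAt-updates j (y i))
...   | no j≢j′ = sym (updateAt-minimal j′ j (y i) (j≢j′ ∘ sym))

flipAt-other : ∀ {n ms} (y : B n ms) i j i′ → i′ ≢ i → flipAt y i j i′ ≗ y i′
flipAt-other y i j i′ i′≢i j′ with i Fin.≟ i′
... | yes refl = contradiction refl i′≢i
... | no _ = refl

totalInversions : ∀ {n ms} → B n ms → ℕ
totalInversions y = sum (λ i → inversions (y i))

inversionFree⇒admissible : ∀ {n ms} (y : B n ms) → (∀ i → inversions (y i) ≡ 0) → Admissible y
inversionFree⇒admissible y free = (λ i → fromℕ< (s≤s (bsum≤ (y i)))) , λ i j →
  subst (λ c → threshold c j ≡ y i j) (sym (toℕ-fromℕ< (s≤s (bsum≤ (y i)))))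
    (sym (inversions≡0⇒threshold (y i) (free i) j))

module _ {n ms} (F : B n ms → B n ms)
         (admissibleImage : ∀ x → Admissible (F x))
         (boundedChange : ∀ x i → ∣ bsum (F x i) - bsum (x i) ∣ ≤ 1) where

  improvingEdge : ∀ y i → 0 < inversions (y i) →
    ∃[ j ] ADEdge F y (flipAt y i j) × totalInversions (flipAt y i j) < totalInversions y
  improvingEdge y i pos with admissibleImage y
  ... | x , βx≗Fy with improvingFlip (toℕ (x i)) (y i) pos
                         (subst (λ c → ∣ c - bsum (y i) ∣ ≤ 1)
                                (trans (sym (bsum-cong (βx≗Fy i))) (bsum-β x i))
                                (boundedChange y i))
  ... | j , disagree , fewer =
    j , (i , j , trans (sym (βx≗Fy i j)) disagree , λ _ _ → refl) ,
    sum-decrease _ _ i (λ i′ i′≢i → inversions-cong (flipAt-other y i j i′ i′≢i))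
                       (subst (_< inversions (y i)) (sym (inversions-cong (flipAt-same y i j))) fewer)

  reachAdmissible : ∀ y → Acc _<_ (totalInversions y) → Σ (B n ms) λ z → Admissible z × Path F y z
  reachAdmissible y (acc smaller) with all? (λ i → inversions (y i) ≟ 0)
  ... | yes free = y , inversionFree⇒admissible y free , ε
  ... | no ¬free with ¬∀⟶∃¬ n _ (λ i → inversions (y i) ≟ 0) ¬free
  ...   | i , nonzero with improvingEdge y i (n≢0⇒n>0 nonzero)
  ...     | j , edge , fewer with reachAdmissible (flipAt y i j) (smaller fewer)
  ...       | z , admissible , path = z , admissible , edge ◅ path

proposition2 : (n : ℕ) → 1 ≤ n → (ms : Fin n → ℕ) → (∀ i → 1 ≤ ms i)
    → (f : X n ms → X n ms) → (F : B n ms → B n ms)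
    → IsBooleanConversion f F
    → (∀ x → Admissible (F x))
    → (∀ x i → ∣ bsum (F x i) - bsum (x i) ∣ ≤ 1)
    → ∀ (x : B n ms) → Σ (B n ms) λ y → Admissible y × Path F x y
proposition2 n _ ms _ f F _ admissibleImage boundedChange x =
  reachAdmissible F admissibleImage boundedChange x (<-wellFounded (totalInversions x))
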